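{- Let $(G,\le_G)$ be an ordered group and $A,B\in\mathrm{P}_{\mathrm{fe}}^*(G)$. The following are equivalent: (1) $A\vdash_{\rhd_{\mathrm s}}B$; (2) there is an integer $n\ge1$ and elements $a\in A^{(n)}$, $b\in B^{(n)}$ such that $a\le_G b$.
   Context: Groups are commutative; an ordered group has a partial order compatible with addition. $\mathrm{P}_{\mathrm{fe}}^*(G)$ is the set of nonempty finite subsets of $G$; $A^{(n)}=A+\dots+A$ ($n$ times) with $A+B=\{a+b\}$; $A-B=\{a-b\}$, $x+A=\{x+a\}$. $A\rhd_{\mathrm s}b$ iff $a\le_G b$ for some $a\in A$. A system of ideals for $G$ is a relation $\rhd$ between $\mathrm{P}_{\mathrm{fe}}^*(G)$ and $G$ with $a\rhd a$; $A\rhd b\Rightarrow A\cup A'\rhd b$; ($A\rhd c$ and $A\cup\{c\}\rhd b$) $\Rightarrow A\rhd b$; $a\le_G b\Rightarrow a\rhd b$; $A\rhd b\Rightarrow x+A\rhd x+b$. For $y_i\in G$, $\rhd_{y_1,\dots,y_n}$ is the finest system of ideals containing $\rhd$ with $0\rhd_{y_1,\dots,y_n}y_i$ for all $i$. Regularisation: $A\vdash_\rhd B$ iff there exist $x_1,\dots,x_m\in G$ with $A-B\rhd_{\pm x_1,\dots,\pm x_m}0$ for every choice of signs. -}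

module Defs where

open import Level using (Level; _⊔_; suc)
open import Data.Nat using (ℕ; zero; suc)
open import Data.Bool using (Bool; true; false)
open import Data.List using (List; []; _∷_; [_]; map; cartesianProductWith)
open import Data.Vec using (Vec; []; _∷_; toList; zipWith)
open import Data.List.Membership.Propositional using (_∈_)
open import Data.List.Relation.Binary.Subset.Propositional using (_⊆_)
open import Data.Product using (Σ; ∃; ∃-syntax; _×_; _,_)
open import Relation.Binary.PropositionalEquality using (_≡_)
open import Relation.Binary.Structures using (IsPartialOrder)
open import Algebra.Structures using (IsAbelianGroup)

record OrderedGroup (c ℓ : Level) : Set (Level.suc (c ⊔ ℓ)) where
  infixl 6 _+_
  infix 4 _≤_
  field
    Carrier        : Set c
    _+_            : Carrier → Carrier → Carrier
    0#             : Carrier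
    -_             : Carrier → Carrier
    _≤_            : Carrier → Carrier → Set ℓ
    isAbelianGroup : IsAbelianGroup _≡_ _+_ 0# -_
    isPartialOrder : IsPartialOrder _≡_ _≤_
    ≤-compat       : ∀ {a b} (x : Carrier) → a ≤ b → x + a ≤ x + b

  _-_ : Carrier → Carrier → Carrier
  a - b = a + (- b)

module _ {c ℓ : Level} (G : OrderedGroup c ℓ) where
  open OrderedGroup G

  -- Finite subsets of G are represented by lists (nonemptiness is a
  -- separate hypothesis where needed).

  _⊕_ : List Carrier → List Carrier → List Carrier
  A ⊕ B = cartesianProductWith _+_ A B

  _⊖_ : List Carrier → List Carrier → List Carrier
  A ⊖ B = cartesianProductWith _-_ A B

  -- A^(n) = A + ... + A (n times); A^(0) = {0} (only used for n ≥ 1)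
  sumPow : ℕ → List Carrier → List Carrier
  sumPow zero    A = [ 0# ]
  sumPow (suc n) A = A ⊕ sumPow n A

  _+ˢ_ : Carrier → List Carrier → List Carrier
  x +ˢ A = map (x +_) A

  ▷s : List Carrier → Carrier → Set (c ⊔ ℓ)
  ▷s A b = ∃[ a ] (a ∈ A × a ≤ b)

  -- The finest system of ideals containing R with 0 ▷ y for all y ∈ ys:
  -- the inductive closure of R and {0} ▷ y under the system-of-ideals axioms.
  -- (Weakening along ⊆ expresses A ▷ b ⇒ A ∪ A' ▷ b, and makes the relation
  -- depend only on the underlying set of a list.)
  data Gen (R : List Carrier → Carrier → Set (c ⊔ ℓ)) (ys : List Carrier)
       : List Carrier → Carrier → Set (c ⊔ ℓ) where
    base   : ∀ {A b} → R A b → Gen R ys A b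
    gen    : ∀ {y} → y ∈ ys → Gen R ys [ 0# ] y
    refl▷  : ∀ a → Gen R ys [ a ] a
    order  : ∀ {a b} → a ≤ b → Gen R ys [ a ] b
    weaken : ∀ {A A' b} → A ⊆ A' → Gen R ys A b → Gen R ys A' b
    cut    : ∀ {A b c'} → Gen R ys A c' → Gen R ys (c' ∷ A) b → Gen R ys A b
    transl : ∀ {A b} x → Gen R ys A b → Gen R ys (x +ˢ A) (x + b)

  signed : Bool → Carrier → Carrier
  signed true  x = x
  signed false x = - x

  Reg : (R : List Carrier → Carrier → Set (c ⊔ ℓ)) →
        List Carrier → List Carrier → Set (c ⊔ ℓ)
  Reg R A B = Σ ℕ λ m → Σ (Vec Carrier m) λ xs →
    (s : Vec Bool m) → Gen R (toList (zipWith signed s xs)) (A ⊖ B) 0#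

-- Let Cone(zs) be the monoid generated by the nonnegative elements and zs.
-- The system (▷s)_{zs} is  L ▷ b ⟺ b ∈ L + Cone(zs),  so A ⊢ B says: for
-- every choice of signs, b ∈ a + Cone(±x₁,…,±xₘ) for some a ∈ A, b ∈ B.
-- A generator x is eliminated by combining a certificate
-- b₁ ∈ a₁ + k₁x + Cone(zs) with a certificate b₂ ∈ a₂ - k₂x + Cone(zs):
-- scaling by k₂ and k₁ and adding cancels x, at the price of replacing A, B
-- by A^(n), B^(n).  Once every generator is gone, b ∈ a + Cone() means a ≤ b.
-- Conversely, if a ≤ b with a = Σ aᵢ, b = Σ bᵢ, take xᵢ = aᵢ - bᵢ: a sign
-- choice either contains some -xᵢ, and xᵢ + (-xᵢ) = 0, or contains every xᵢ,
-- and then 0 = x₁ + (x₂ + … + xₙ + (b - a)).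
module Submission where

open import Defs
open import Level using (Level; _⊔_)
open import Data.Nat using (ℕ; _≤_)
open import Data.List using (List; [])
open import Data.List.Membership.Propositional using (_∈_)
open import Data.Product using (∃-syntax; _×_)
open import Function.Bundles using (_⇔_)
open import Relation.Binary.PropositionalEquality using (_≢_)

open import Algebra.Bundles using (AbelianGroup)
open import Algebra.Structures using (IsAbelianGroup)
open import Data.Bool using (Bool; true; false)
open import Data.List using (_∷_; [_])
open import Data.List.Relation.Unary.Any using (here; there)
open import Data.List.Membership.Propositional.Properties
  using (∈-cartesianProductWith⁺; ∈-cartesianProductWith⁻; ∈-map⁺)
open import Data.List.Relation.Binary.Subset.Propositional using (_⊆_)
open import Data.Nat using (zero; suc; _*_; s≤s; z≤n)
import Data.Nat as ℕ
open import Data.Nat.Properties using (*-comm; ≤-trans; m≤n*m; m≤n+m)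
open import Data.Product using (_,_)
open import Data.Sum using (_⊎_; inj₁; inj₂)
open import Data.Vec using (Vec; toList; zipWith; foldr′)
  renaming ([] to []ᵛ; _∷_ to _∷ᵛ_)
open import Function.Bundles using (mk⇔)
open import Relation.Binary.Structures using (IsPartialOrder)
open import Relation.Binary.PropositionalEquality
  using (_≡_; refl; sym; trans; cong; subst; subst₂; module ≡-Reasoning)

module AbelianGroupMultiples {a ℓ} (H : AbelianGroup a ℓ) where
  open AbelianGroup H renaming (sym to ≈-sym; trans to ≈-trans)
  open import Algebra.Properties.AbelianGroup H using (⁻¹-∙-comm)
  open import Algebra.Properties.Group group using (ε⁻¹≈ε)
  open import Algebra.Properties.CommutativeSemigroup commutativeSemigroup
    using (interchange)
  open import Algebra.Properties.CommutativeMonoid.Mult commutativeMonoid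
    using (×-distrib-+; ×-assocˡ; ×-congˡ; ×-congʳ) renaming (_×_ to _·_)
  open import Relation.Binary.Reasoning.Setoid setoid

  ·-⁻¹ : ∀ n x → n · (x ⁻¹) ≈ (n · x) ⁻¹
  ·-⁻¹ zero    x = ≈-sym ε⁻¹≈ε
  ·-⁻¹ (suc n) x = ≈-trans (∙-congˡ (·-⁻¹ n x)) (⁻¹-∙-comm x (n · x))

  ·-swap : ∀ m n x → m · (n · x) ≈ n · (m · x)
  ·-swap m n x = begin
    m · (n · x)    ≈⟨ ×-assocˡ x m n ⟩
    (m * n) · x  ≈⟨ ×-congˡ (*-comm m n) ⟩
    (n * m) · x  ≈⟨ ×-assocˡ x n m ⟨
    n · (m · x)    ∎

  ·-cross-cancel : ∀ k l u v x →
    k · (u ∙ l · x) ∙ l · (v ∙ k · (x ⁻¹)) ≈ k · u ∙ l · v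
  ·-cross-cancel k l u v x = begin
    k · (u ∙ l · x) ∙ l · (v ∙ k · (x ⁻¹))
      ≈⟨ ∙-cong (×-distrib-+ u (l · x) k) (×-distrib-+ v (k · (x ⁻¹)) l) ⟩
    (k · u ∙ k · (l · x)) ∙ (l · v ∙ l · (k · (x ⁻¹)))
      ≈⟨ interchange (k · u) (k · (l · x)) (l · v) (l · (k · (x ⁻¹))) ⟩
    (k · u ∙ l · v) ∙ (k · (l · x) ∙ l · (k · (x ⁻¹)))
      ≈⟨ ∙-congˡ (∙-congˡ (×-congʳ l (·-⁻¹ k x))) ⟩
    (k · u ∙ l · v) ∙ (k · (l · x) ∙ l · ((k · x) ⁻¹))
      ≈⟨ ∙-congˡ (∙-congˡ (·-⁻¹ l (k · x))) ⟩
    (k · u ∙ l · v) ∙ (k · (l · x) ∙ (l · (k · x)) ⁻¹)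
      ≈⟨ ∙-congˡ (∙-congˡ (⁻¹-cong (·-swap l k x))) ⟩
    (k · u ∙ l · v) ∙ (k · (l · x) ∙ (k · (l · x)) ⁻¹)
      ≈⟨ ∙-congˡ (inverseʳ (k · (l · x))) ⟩
    (k · u ∙ l · v) ∙ ε
      ≈⟨ identityʳ (k · u ∙ l · v) ⟩
    k · u ∙ l · v ∎

  ∙⁻¹-interchange : ∀ u v u′ v′ → (u ∙ v ⁻¹) ∙ (u′ ∙ v′ ⁻¹) ≈ (u ∙ u′) ∙ (v ∙ v′) ⁻¹
  ∙⁻¹-interchange u v u′ v′ =
    ≈-trans (interchange u (v ⁻¹) u′ (v′ ⁻¹)) (∙-congˡ (⁻¹-∙-comm v v′))

module _ {c ℓ : Level} (G : OrderedGroup c ℓ) where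
  open OrderedGroup G renaming (_≤_ to _≤G_)
  open IsAbelianGroup isAbelianGroup using (assoc; comm; identityˡ; identityʳ; inverseˡ; inverseʳ)
  open IsPartialOrder isPartialOrder using () renaming (refl to ≤G-refl; trans to ≤G-trans)
  open ≡-Reasoning

  +-abelianGroup : AbelianGroup c c
  +-abelianGroup = record { isAbelianGroup = isAbelianGroup }

  open AbelianGroup +-abelianGroup using (commutativeSemigroup; commutativeMonoid)
  open import Algebra.Properties.CommutativeSemigroup commutativeSemigroup
    using (interchange)
  open import Algebra.Properties.CommutativeMonoid.Mult commutativeMonoid
    using (×-homo-+) renaming (_×_ to _·_)
  open AbelianGroupMultiples +-abelianGroup

  ≤⇒0≤- : ∀ {a b} → a ≤G b → 0# ≤G b - a
  ≤⇒0≤- {a} {b} a≤b = subst₂ _≤G_ (inverseˡ a) (comm (- a) b) (≤-compat (- a) a≤b)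

  0≤⇒≤+ : ∀ a {m} → 0# ≤G m → a ≤G a + m
  0≤⇒≤+ a 0≤m = subst (_≤G a + _) (identityʳ a) (≤-compat a 0≤m)

  data Cone (zs : List Carrier) : Carrier → Set (c ⊔ ℓ) where
    nonneg : ∀ {x} → 0# ≤G x → Cone zs x
    elem   : ∀ {z} → z ∈ zs → Cone zs z
    add    : ∀ {x y} → Cone zs x → Cone zs y → Cone zs (x + y)

  Cone-[]⇒0≤ : ∀ {x} → Cone [] x → 0# ≤G x
  Cone-[]⇒0≤ (nonneg 0≤x) = 0≤x
  Cone-[]⇒0≤ (add {x} cx cy) = ≤G-trans (Cone-[]⇒0≤ cx) (0≤⇒≤+ x (Cone-[]⇒0≤ cy))

  Cone-∷⁻ : ∀ {z zs x} → Cone (z ∷ zs) x → ∃[ k ] ∃[ p ] (Cone zs p × x ≡ k · z + p)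
  Cone-∷⁻ (nonneg 0≤x)       = 0 , _ , nonneg 0≤x , sym (identityˡ _)
  Cone-∷⁻ (elem (here refl)) = 1 , 0# , nonneg ≤G-refl , sym (trans (identityʳ _) (identityʳ _))
  Cone-∷⁻ (elem (there z∈))  = 0 , _ , elem z∈ , sym (identityˡ _)
  Cone-∷⁻ {z} (add cx cy) with Cone-∷⁻ cx | Cone-∷⁻ cy
  ... | k , p , cp , refl | l , q , cq , refl =
    k ℕ.+ l , p + q , add cp cq ,
    trans (interchange (k · z) p (l · z) q) (cong (_+ (p + q)) (sym (×-homo-+ z k l)))

  infix 4 _≼⟨_⟩_
  _≼⟨_⟩_ : Carrier → List Carrier → Carrier → Set (c ⊔ ℓ)
  a ≼⟨ zs ⟩ b = ∃[ m ] (Cone zs m × b ≡ a + m)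

  ≼-refl : ∀ {zs} a → a ≼⟨ zs ⟩ a
  ≼-refl a = 0# , nonneg ≤G-refl , sym (identityʳ a)

  ≼-trans : ∀ {zs a b c} → a ≼⟨ zs ⟩ b → b ≼⟨ zs ⟩ c → a ≼⟨ zs ⟩ c
  ≼-trans (m , cm , refl) (n , cn , refl) = m + n , add cm cn , assoc _ m n

  +-mono-≼ : ∀ {zs a b a′ b′} → a ≼⟨ zs ⟩ b → a′ ≼⟨ zs ⟩ b′ → a + a′ ≼⟨ zs ⟩ b + b′
  +-mono-≼ (m , cm , refl) (n , cn , refl) = m + n , add cm cn , interchange _ m _ n

  ·-monoʳ-≼ : ∀ {zs a b} k → a ≼⟨ zs ⟩ b → k · a ≼⟨ zs ⟩ k · b
  ·-monoʳ-≼ zero    _   = ≼-refl 0#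
  ·-monoʳ-≼ (suc k) a≼b = +-mono-≼ a≼b (·-monoʳ-≼ k a≼b)

  ≤⇒≼ : ∀ {zs a b} → a ≤G b → a ≼⟨ zs ⟩ b
  ≤⇒≼ {a = a} {b} a≤b = b - a , nonneg (≤⇒0≤- a≤b) , (begin
    b              ≡⟨ identityˡ b ⟨
    0# + b         ≡⟨ cong (_+ b) (inverseʳ a) ⟨
    (a + - a) + b  ≡⟨ assoc a (- a) b ⟩
    a + (- a + b)  ≡⟨ cong (a +_) (comm (- a) b) ⟩
    a + (b - a)    ∎)

  ≼[]⇒≤ : ∀ {a b} → a ≼⟨ [] ⟩ b → a ≤G b
  ≼[]⇒≤ {a} (m , cm , refl) = 0≤⇒≤+ a (Cone-[]⇒0≤ cm)

  ≼-∷⁻ : ∀ {z zs a b} → a ≼⟨ z ∷ zs ⟩ b → ∃[ k ] (a + k · z ≼⟨ zs ⟩ b)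
  ≼-∷⁻ {a = a} (m , cm , refl) with Cone-∷⁻ cm
  ... | k , p , cp , refl = k , p , cp , sym (assoc a _ p)

  -≼0⇒≼ : ∀ {zs a b} → a - b ≼⟨ zs ⟩ 0# → a ≼⟨ zs ⟩ b
  -≼0⇒≼ {a = a} {b} a-b≼0 = subst₂ (_≼⟨ _ ⟩_) a-b+b≡a (identityˡ b) (+-mono-≼ a-b≼0 (≼-refl b))
    where
    a-b+b≡a : (a - b) + b ≡ a
    a-b+b≡a = trans (assoc a (- b) b) (trans (cong (a +_) (inverseˡ b)) (identityʳ a))

  Gen-▷s : List Carrier → List Carrier → Carrier → Set (c ⊔ ℓ)
  Gen-▷s = Gen G (▷s G)

  Gen-▷s⇒≼ : ∀ {zs L b} → Gen-▷s zs L b → ∃[ l ] (l ∈ L × l ≼⟨ zs ⟩ b)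
  Gen-▷s⇒≼ (base (a , a∈ , a≤b)) = a , a∈ , ≤⇒≼ a≤b
  Gen-▷s⇒≼ (gen z∈)              = 0# , here refl , _ , elem z∈ , sym (identityˡ _)
  Gen-▷s⇒≼ (refl▷ a)             = a , here refl , ≼-refl a
  Gen-▷s⇒≼ (order a≤b)           = _ , here refl , ≤⇒≼ a≤b
  Gen-▷s⇒≼ (weaken L⊆L′ g) with Gen-▷s⇒≼ g
  ... | l , l∈ , l≼b = l , L⊆L′ l∈ , l≼b
  Gen-▷s⇒≼ (cut g g′) with Gen-▷s⇒≼ g | Gen-▷s⇒≼ g′
  ... | l , l∈ , l≼c | _ , here refl , c≼b = l , l∈ , ≼-trans l≼c c≼b
  ... | _ | l , there l∈ , l≼b = l , l∈ , l≼b
  Gen-▷s⇒≼ (transl x g) with Gen-▷s⇒≼ g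
  ... | l , l∈ , l≼b = x + l , ∈-map⁺ (x +_) l∈ , +-mono-≼ (≼-refl x) l≼b

  Cone⇒Gen-▷s : ∀ {zs m} → Cone zs m → Gen-▷s zs [ 0# ] m
  Cone⇒Gen-▷s (nonneg 0≤m)        = order 0≤m
  Cone⇒Gen-▷s (elem z∈)           = gen z∈
  Cone⇒Gen-▷s (add {x} cx cy) = cut (Cone⇒Gen-▷s cx) (weaken x+0⊆ (transl x (Cone⇒Gen-▷s cy)))
    where
    x+0⊆ : [ x + 0# ] ⊆ x ∷ [ 0# ]
    x+0⊆ (here refl) = here (identityʳ x)

  ≼⇒Gen-▷s : ∀ {zs L l b} → l ∈ L → l ≼⟨ zs ⟩ b → Gen-▷s zs L b
  ≼⇒Gen-▷s {L = L} {l} l∈ (m , cm , refl) = weaken l+0⊆ (transl l (Cone⇒Gen-▷s cm))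
    where
    l+0⊆ : [ l + 0# ] ⊆ L
    l+0⊆ (here refl) = subst (_∈ L) (sym (identityʳ l)) l∈

  ∈⇒∈sumPow1 : ∀ {X a} → a ∈ X → a ∈ sumPow G 1 X
  ∈⇒∈sumPow1 {a = a} a∈ = subst (_∈ _) (identityʳ a) (∈-cartesianProductWith⁺ _+_ a∈ (here refl))

  ∈sumPow-+ : ∀ {X} m n {a a′} → a ∈ sumPow G m X → a′ ∈ sumPow G n X →
              a + a′ ∈ sumPow G (m ℕ.+ n) X
  ∈sumPow-+ zero    n (here refl) a′∈ = subst (_∈ _) (sym (identityˡ _)) a′∈
  ∈sumPow-+ {X} (suc m) n {a′ = a′} a∈ a′∈ with ∈-cartesianProductWith⁻ _+_ X (sumPow G m X) a∈
  ... | x , r , x∈ , r∈ , refl = subst (_∈ sumPow G (suc m ℕ.+ n) X) (sym (assoc x r a′))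
    (∈-cartesianProductWith⁺ _+_ x∈ (∈sumPow-+ m n r∈ a′∈))

  ∈sumPow-· : ∀ {X} k n {a} → a ∈ sumPow G n X → k · a ∈ sumPow G (k * n) X
  ∈sumPow-· zero    n a∈ = here refl
  ∈sumPow-· (suc k) n a∈ = ∈sumPow-+ n (k * n) a∈ (∈sumPow-· k n a∈)

  sumᵛ : ∀ {n} → Vec Carrier n → Carrier
  sumᵛ = foldr′ _+_ 0#

  Cone-sumᵛ : ∀ {zs n} (ds : Vec Carrier n) → toList ds ⊆ zs → Cone zs (sumᵛ ds)
  Cone-sumᵛ []ᵛ       _     = nonneg ≤G-refl
  Cone-sumᵛ (d ∷ᵛ ds) ds⊆zs = add (elem (ds⊆zs (here refl))) (Cone-sumᵛ ds (λ d∈ → ds⊆zs (there d∈)))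

  signedList : ∀ {m} → Vec Bool m → Vec Carrier m → List Carrier
  signedList s xs = toList (zipWith (signed G) s xs)

  negated⊎⊆signedList : ∀ {m} (ds : Vec Carrier m) (s : Vec Bool m) →
    (∃[ d ] (d ∈ toList ds × - d ∈ signedList s ds)) ⊎ (toList ds ⊆ signedList s ds)
  negated⊎⊆signedList []ᵛ []ᵛ = inj₂ (λ ())
  negated⊎⊆signedList (d ∷ᵛ ds) (false ∷ᵛ s) = inj₁ (d , here refl , here refl)
  negated⊎⊆signedList (d ∷ᵛ ds) (true  ∷ᵛ s) with negated⊎⊆signedList ds s
  ... | inj₁ (d′ , d′∈ , -d′∈) = inj₁ (d′ , there d′∈ , there -d′∈)
  ... | inj₂ ds⊆ = inj₂ λ { (here refl) → here refl ; (there d′∈) → there (ds⊆ d′∈) }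

  module _ (A B : List Carrier) where

    ∈sumPow⇒sumᵛ⊖ : ∀ n {a b} → a ∈ sumPow G n A → b ∈ sumPow G n B →
      ∃[ ds ] (toList {n = n} ds ⊆ _⊖_ G A B × sumᵛ ds ≡ a - b)
    ∈sumPow⇒sumᵛ⊖ zero (here refl) (here refl) = []ᵛ , (λ ()) , sym (inverseʳ 0#)
    ∈sumPow⇒sumᵛ⊖ (suc n) a∈ b∈
      with ∈-cartesianProductWith⁻ _+_ A (sumPow G n A) a∈
         | ∈-cartesianProductWith⁻ _+_ B (sumPow G n B) b∈
    ... | a₁ , a′ , a₁∈ , a′∈ , refl | b₁ , b′ , b₁∈ , b′∈ , refl
      with ∈sumPow⇒sumᵛ⊖ n a′∈ b′∈
    ... | ds , ds⊆ , sum≡ =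
      (a₁ - b₁) ∷ᵛ ds , ∷⊆ , trans (cong ((a₁ - b₁) +_) sum≡) (∙⁻¹-interchange a₁ b₁ a′ b′)
      where
      ∷⊆ : toList ((a₁ - b₁) ∷ᵛ ds) ⊆ _⊖_ G A B
      ∷⊆ (here refl) = ∈-cartesianProductWith⁺ _-_ a₁∈ b₁∈
      ∷⊆ (there d∈)  = ds⊆ d∈

    Certificate : List Carrier → Set (c ⊔ ℓ)
    Certificate zs = ∃[ n ] (1 ≤ n × ∃[ a ] ∃[ b ]
      (a ∈ sumPow G n A × b ∈ sumPow G n B × a ≼⟨ zs ⟩ b))

    eliminate : ∀ {x ys} → Certificate (x ∷ ys) → Certificate (- x ∷ ys) → Certificate ys
    eliminate (n₁ , 1≤n₁ , a₁ , b₁ , a₁∈ , b₁∈ , c₁) (n₂ , 1≤n₂ , a₂ , b₂ , a₂∈ , b₂∈ , c₂)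
      with ≼-∷⁻ c₁ | ≼-∷⁻ c₂
    -- if the first certificate does not use x, it is already one over ys
    ... | zero , a₁≼b₁ | _ = n₁ , 1≤n₁ , a₁ , b₁ , a₁∈ , b₁∈ , subst (_≼⟨ _ ⟩ b₁) (identityʳ a₁) a₁≼b₁
    ... | k₁@(suc _) , c₁′ | k₂ , c₂′ =
      k₂ * n₁ ℕ.+ k₁ * n₂ , 1≤n ,
      k₂ · a₁ + k₁ · a₂ , k₂ · b₁ + k₁ · b₂ ,
      ∈sumPow-+ (k₂ * n₁) (k₁ * n₂) (∈sumPow-· k₂ n₁ a₁∈) (∈sumPow-· k₁ n₂ a₂∈) ,
      ∈sumPow-+ (k₂ * n₁) (k₁ * n₂) (∈sumPow-· k₂ n₁ b₁∈) (∈sumPow-· k₁ n₂ b₂∈) ,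
      subst (_≼⟨ _ ⟩ k₂ · b₁ + k₁ · b₂) (·-cross-cancel k₂ k₁ a₁ a₂ _)
        (+-mono-≼ (·-monoʳ-≼ k₂ c₁′) (·-monoʳ-≼ k₁ c₂′))
      where
      1≤n : 1 ≤ k₂ * n₁ ℕ.+ k₁ * n₂
      1≤n = ≤-trans 1≤n₂ (≤-trans (m≤n*m n₂ k₁) (m≤n+m (k₁ * n₂) (k₂ * n₁)))

    eliminateAll : ∀ {m} (xs : Vec Carrier m) →
      (∀ s → Certificate (signedList s xs)) → Certificate []
    eliminateAll []ᵛ        cert = cert []ᵛ
    eliminateAll (x ∷ᵛ xs) cert =
      eliminateAll xs (λ s → eliminate (cert (true ∷ᵛ s)) (cert (false ∷ᵛ s)))

    Gen-▷s⇒Certificate : ∀ {zs} → Gen-▷s zs (_⊖_ G A B) 0# → Certificate zs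
    Gen-▷s⇒Certificate g with Gen-▷s⇒≼ g
    ... | l , l∈ , l≼0 with ∈-cartesianProductWith⁻ _-_ A B l∈
    ... | a , b , a∈ , b∈ , refl =
      1 , s≤s z≤n , a , b , ∈⇒∈sumPow1 a∈ , ∈⇒∈sumPow1 b∈ , -≼0⇒≼ l≼0

    Reg⇒≤ : Reg G (▷s G) A B →
      ∃[ n ] (1 ≤ n × ∃[ a ] ∃[ b ] (a ∈ sumPow G n A × b ∈ sumPow G n B × a ≤G b))
    Reg⇒≤ (_ , xs , gens) with eliminateAll xs (λ s → Gen-▷s⇒Certificate (gens s))
    ... | n , 1≤n , a , b , a∈ , b∈ , a≼b = n , 1≤n , a , b , a∈ , b∈ , ≼[]⇒≤ a≼b

    ≤⇒Reg : ∃[ n ] (1 ≤ n × ∃[ a ] ∃[ b ] (a ∈ sumPow G n A × b ∈ sumPow G n B × a ≤G b)) →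
      Reg G (▷s G) A B
    ≤⇒Reg (suc n , _ , a , b , a∈ , b∈ , a≤b) with ∈sumPow⇒sumᵛ⊖ (suc n) a∈ b∈
    ... | d ∷ᵛ ds , ⊆⊖ , sum≡ = suc n , d ∷ᵛ ds , reaches0
      where
      d+gap≡0 : d + (sumᵛ ds + (b - a)) ≡ 0#
      d+gap≡0 = begin
        d + (sumᵛ ds + (b - a))  ≡⟨ assoc d (sumᵛ ds) (b - a) ⟨
        (d + sumᵛ ds) + (b - a)  ≡⟨ cong (_+ (b - a)) sum≡ ⟩
        (a - b) + (b - a)        ≡⟨ ∙⁻¹-interchange a b b a ⟩
        (a + b) - (b + a)        ≡⟨ cong (λ t → (a + b) - t) (comm b a) ⟩
        (a + b) - (a + b)        ≡⟨ inverseʳ (a + b) ⟩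
        0#                       ∎
      reaches0 : ∀ s → Gen-▷s (signedList s (d ∷ᵛ ds)) (_⊖_ G A B) 0#
      reaches0 s with negated⊎⊆signedList (d ∷ᵛ ds) s
      ... | inj₁ (d′ , d′∈ , -d′∈) = ≼⇒Gen-▷s (⊆⊖ d′∈) (- d′ , elem -d′∈ , sym (inverseʳ d′))
      ... | inj₂ ⊆signed = ≼⇒Gen-▷s (⊆⊖ (here refl))
        (_ , add (Cone-sumᵛ ds (λ d′∈ → ⊆signed (there d′∈))) (nonneg (≤⇒0≤- a≤b)) , sym d+gap≡0)

corollary4p14 : ∀ {c ℓ : Level} (G : OrderedGroup c ℓ)
    (A B : List (OrderedGroup.Carrier G)) → A ≢ [] → B ≢ [] →
    Reg G (▷s G) A B ⇔
    (∃[ n ] (1 ≤ n × ∃[ a ] ∃[ b ] (a ∈ sumPow G n A × b ∈ sumPow G n B × OrderedGroup._≤_ G a b)))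
-- Nonemptiness of A and B is implied by either side.
corollary4p14 G A B _ _ = mk⇔ (Reg⇒≤ G A B) (≤⇒Reg G A B)
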